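{- Let $G$ be a finite abelian group, and let $r>q\geq 0$ and $m\geq |G|$ be integers with $\exp(G)\mid m$. Then $$R(S(r,q,m),G)\leq \min_{0\leq p\leq q}\big\{p+R(S(r-p,q-p,m),G)\big\}.$$
   Context: $\exp(G)$ is the exponent of $G$. A collection of $m$ distinct $r$-sets $e_1,\dots,e_m$ is a delta-system of type $S(r,q,m)$ ($0\le q<r$) if there is a set $Q$ with $|Q|=q$ such that $e_i\cap e_j=Q$ for all $i<j$. $K_d^{(r)}$ is the complete $r$-uniform hypergraph on $d$ vertices. $R(S(r,q,m),G)$ is the smallest positive integer $d$ such that for every map $c$ from the edge set of $K_d^{(r)}$ to $G$ there is a delta-system $e_1,\dots,e_m$ of type $S(r,q,m)$ consisting of edges of $K_d^{(r)}$ with $\sum_{i=1}^m c(e_i)=0$. -}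

module Defs where

open import Level using (Level)
open import Algebra.Bundles using (AbelianGroup)
open import Data.Nat using (ℕ; zero; suc; _≤_)
open import Data.Fin using (Fin)
import Data.Fin as F
open import Data.Fin.Subset using (Subset; ∣_∣; _∩_)
open import Data.Product using (Σ; ∃; _×_; _,_)
open import Relation.Binary.PropositionalEquality using (_≡_; _≢_)

module _ {c ℓ : Level} (G : AbelianGroup c ℓ) where
  open AbelianGroup G

  times : ℕ → Carrier → Carrier
  times zero    x = ε
  times (suc n) x = x ∙ times n x

  gsum : ∀ {m} → (Fin m → Carrier) → Carrier
  gsum {zero}  f = ε
  gsum {suc m} f = f F.zero ∙ gsum (λ i → f (F.suc i))

  HasOrder : ℕ → Set (c Level.⊔ ℓ)
  HasOrder n = Σ (Fin n → Carrier) λ f →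
    (∀ x → ∃ λ i → f i ≈ x) × (∀ i j → f i ≈ f j → i ≡ j)

  IsExponent : ℕ → Set (c Level.⊔ ℓ)
  IsExponent e = (1 ≤ e) × (∀ x → times e x ≈ ε)
    × (∀ e' → 1 ≤ e' → (∀ x → times e' x ≈ ε) → e ≤ e')

  -- edges of K_d^(r): r-subsets of Fin d; a colouring assigns an element of G to each
  Colouring : ℕ → ℕ → Set c
  Colouring r d = (e : Subset d) → ∣ e ∣ ≡ r → Carrier

  -- a delta-system of type S(r,q,m) in K_d^(r) whose colour sum is zero
  ZeroSumDelta : (r q m d : ℕ) → Colouring r d → Set _
  ZeroSumDelta r q m d col =
    Σ (Fin m → Subset d) λ es →
    Σ (∀ i → ∣ es i ∣ ≡ r) λ isEdge →
      (∀ i j → i ≢ j → es i ≢ es j)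
    × (∃ λ (Q : Subset d) → ∣ Q ∣ ≡ q × (∀ i j → i ≢ j → es i ∩ es j ≡ Q))
    × (gsum (λ i → col (es i) (isEdge i)) ≈ ε)

  RamseyProp : (r q m d : ℕ) → Set _
  RamseyProp r q m d = (col : Colouring r d) → ZeroSumDelta r q m d col

  IsRamseyNumber : (r q m R : ℕ) → Set _
  IsRamseyNumber r q m R = (1 ≤ R) × RamseyProp r q m R
    × (∀ d → 1 ≤ d → RamseyProp r q m d → R ≤ d)

-- Adjoining p fresh vertices to every edge of K_d^(r−p) turns a delta-system of
-- type S(r−p,q−p,m) into one of type S(r,q,m) with the same colour sum (the fresh vertices
-- join the kernel), so every colouring of K_(p+R′)^(r) restricts to one of K_R′^(r−p) whose
-- zero-sum delta-system lifts back. Hence p + R′ has the Ramsey property for S(r,q,m); as the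
-- property is decidable (G and all colourings are finite), a least such number exists.
module Submission where

open import Defs
open import Level using (Level; Setω)
open import Algebra.Bundles using (AbelianGroup)
open import Data.Nat using (ℕ; _≤_; _<_; _+_; _∸_)
open import Data.Nat.Divisibility using (_∣_)
open import Data.Product using (∃; _×_)

open import Data.Nat using (zero; suc)
open import Data.Nat.Properties as ℕ using (anyUpTo?)
open import Data.Nat.Induction using (<-rec)
open import Data.Bool using (true; false)
import Data.Bool as Bool
open import Data.Fin using (Fin)
import Data.Fin as Fin
open import Data.Fin.Properties using (any?; all?)
open import Data.Fin.Subset using (Subset; ∣_∣; _∩_; inside)
open import Data.Fin.Subset.Properties using (anySubset?)
open import Data.Vec using ([]; _∷_)
open import Data.Vec.Properties using (∷-injectiveʳ; ≡-dec)
import Data.Vec.Functional as Vector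
open import Data.Product using (Σ; _,_; proj₁; proj₂)
open import Data.Empty using (⊥-elim)
open import Function using (_∘_)
open import Relation.Nullary using (Dec; yes; no; ¬?)
open import Relation.Nullary.Decidable using (_×-dec_; _→-dec_)
open import Relation.Unary using (Pred; Decidable)
open import Relation.Binary using (Rel; Symmetric; _Respects_)
open import Relation.Binary.PropositionalEquality
  using (_≡_; _≢_; _≗_; refl; sym; trans; cong; cong₂; subst; subst₂)

Searchable : ∀ {a ℓ} (A : Set a) → Rel A ℓ → Setω
Searchable A _∼_ = ∀ {p} {P : Pred A p} → P Respects _∼_ → Decidable P → Dec (∃ P)

module _ {a ℓ} {A : Set a} {_∼_ : Rel A ℓ} (∼-sym : Symmetric _∼_) (search : Searchable A _∼_) where

  all-dec : ∀ {p} {P : Pred A p} → P Respects _∼_ → Decidable P → Dec (∀ x → P x)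
  all-dec {P = P} resp P? with search (λ x∼y ¬Px Py → ¬Px (resp (∼-sym x∼y) Py)) (¬? ∘ P?)
  ... | yes (x , ¬Px) = no λ all → ¬Px (all x)
  ... | no ∄¬P = yes λ x → decided x (P? x)
    where
    decided : ∀ x → Dec (P x) → P x
    decided x (yes Px) = Px
    decided x (no ¬Px) = ⊥-elim (∄¬P (x , ¬Px))

Fin-searchable : ∀ {n} → Searchable (Fin n) _≡_
Fin-searchable _ = any?

Subset-searchable : ∀ {n} → Searchable (Subset n) _≡_
Subset-searchable _ = anySubset?

module _ {a} {A : Set a} (search : Searchable A _≡_) where

  Vector-searchable : ∀ m → Searchable (Vector.Vector A m) _≗_
  Vector-searchable zero {P = P} resp P? with P? (λ ())
  ... | yes P[] = yes (_ , P[])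
  ... | no ¬P[] = no λ (f , Pf) → ¬P[] (resp (λ ()) Pf)
  Vector-searchable (suc m) {P = P} resp P?
    with search (subst _) (λ x → Vector-searchable m (resp ∘ cons-cong x) (P? ∘ (x Vector.∷_)))
    where
    cons-cong : ∀ x {f g : Vector.Vector A m} → f ≗ g → (x Vector.∷ f) ≗ (x Vector.∷ g)
    cons-cong x f≗g Fin.zero    = refl
    cons-cong x f≗g (Fin.suc i) = f≗g i
  ... | yes (x , f , Pxf) = yes (_ , Pxf)
  ... | no ∄ = no λ (f , Pf) → ∄ (Vector.head f , Vector.tail f , resp eta Pf)
    where
    eta : ∀ {f : Vector.Vector A (suc m)} → f ≗ (Vector.head f Vector.∷ Vector.tail f)
    eta Fin.zero    = refl
    eta (Fin.suc i) = refl

  branch : ∀ {d} → (Subset d → A) → (Subset d → A) → Subset (suc d) → A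
  branch g h (true  ∷ s) = g s
  branch g h (false ∷ s) = h s

  SubsetFun-searchable : ∀ d → Searchable (Subset d → A) _≗_
  SubsetFun-searchable zero {P = P} resp P? with search (subst _) (λ x → P? (λ _ → x))
  ... | yes (x , Px) = yes (_ , Px)
  ... | no ∄ = no λ (f , Pf) → ∄ (f [] , resp (λ { [] → refl }) Pf)
  SubsetFun-searchable (suc d) {P = P} resp P?
    with SubsetFun-searchable d (λ g≗g′ (h , Pgh) → h , resp (branch-congˡ g≗g′) Pgh)
           (λ g → SubsetFun-searchable d (resp ∘ branch-congʳ) (P? ∘ branch g))
    where
    branch-congˡ : ∀ {g g′ h} → g ≗ g′ → branch g h ≗ branch g′ h
    branch-congˡ g≗g′ (true  ∷ s) = g≗g′ s
    branch-congˡ g≗g′ (false ∷ s) = refl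
    branch-congʳ : ∀ {g h h′} → h ≗ h′ → branch g h ≗ branch g h′
    branch-congʳ h≗h′ (true  ∷ s) = refl
    branch-congʳ h≗h′ (false ∷ s) = h≗h′ s
  ... | yes (g , h , Pgh) = yes (_ , Pgh)
  ... | no ∄ = no λ (f , Pf) → ∄ (f ∘ (true ∷_) , f ∘ (false ∷_) , resp eta Pf)
    where
    eta : ∀ {f : Subset (suc d) → A} → f ≗ branch (f ∘ (true ∷_)) (f ∘ (false ∷_))
    eta (true  ∷ s) = refl
    eta (false ∷ s) = refl

module _ {p} {P : Pred ℕ p} (P? : Decidable P) where

  least-≤ : ∀ N → P N → ∃ λ R → R ≤ N × P R × (∀ d → P d → R ≤ d)
  least-≤ = <-rec _ step
    where
    step : ∀ N → (∀ {M} → M < N → P M → ∃ λ R → R ≤ M × P R × (∀ d → P d → R ≤ d))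
         → P N → ∃ λ R → R ≤ N × P R × (∀ d → P d → R ≤ d)
    step N rec PN with anyUpTo? P? N
    ... | yes (M , M<N , PM) =
      let R , R≤M , PR , least = rec M<N PM in R , ℕ.≤-trans R≤M (ℕ.<⇒≤ M<N) , PR , least
    ... | no ∄ = N , ℕ.≤-refl , PN , λ d Pd → ℕ.≮⇒≥ λ d<N → ∄ (d , d<N , Pd)

cone : ∀ p {d} → Subset d → Subset (p + d)
cone zero    e = e
cone (suc p) e = inside ∷ cone p e

∣cone∣ : ∀ p {d} (e : Subset d) → ∣ cone p e ∣ ≡ p + ∣ e ∣
∣cone∣ zero    e = refl
∣cone∣ (suc p) e = cong suc (∣cone∣ p e)

cone-edge : ∀ p {d r} {e : Subset d} → ∣ e ∣ ≡ r → ∣ cone p e ∣ ≡ p + r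
cone-edge p {e = e} ∣e∣≡r = trans (∣cone∣ p e) (cong (p +_) ∣e∣≡r)

cone-injective : ∀ p {d} {e e′ : Subset d} → cone p e ≡ cone p e′ → e ≡ e′
cone-injective zero    eq = eq
cone-injective (suc p) eq = cone-injective p (∷-injectiveʳ eq)

cone-∩ : ∀ p {d} (e e′ : Subset d) → cone p e ∩ cone p e′ ≡ cone p (e ∩ e′)
cone-∩ zero    e e′ = refl
cone-∩ (suc p) e e′ = cong (inside ∷_) (cone-∩ p e e′)

_≟ˢ_ : ∀ {k} (e e′ : Subset k) → Dec (e ≡ e′)
_≟ˢ_ = ≡-dec Bool._≟_

module _ {c ℓ} (G : AbelianGroup c ℓ) where
  open AbelianGroup G using (Carrier; _≈_; ε; ∙-cong)
    renaming (refl to ≈-refl; sym to ≈-sym; trans to ≈-trans; reflexive to ≈-reflexive)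

  gsum-cong : ∀ {m} {u v : Fin m → Carrier} → (∀ i → u i ≈ v i) → gsum G u ≈ gsum G v
  gsum-cong {zero}  u≈v = ≈-refl
  gsum-cong {suc m} u≈v = ∙-cong (u≈v Fin.zero) (gsum-cong (u≈v ∘ Fin.suc))

  Colouring-irrelevant : ∀ {r d} (col : Colouring G r d) {e e′} (isEdge : ∣ e ∣ ≡ r) (isEdge′ : ∣ e′ ∣ ≡ r)
    → e ≡ e′ → col e isEdge ≡ col e′ isEdge′
  Colouring-irrelevant col isEdge isEdge′ refl = cong (col _) (ℕ.≡-irrelevant isEdge isEdge′)

  RamseyProp-cone : ∀ p {r q m d} → RamseyProp G r q m d → RamseyProp G (p + r) (p + q) m (p + d)
  RamseyProp-cone p Ramsey col with Ramsey (λ e → col (cone p e) ∘ cone-edge p)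
  ... | es , isEdge , distinct , (Q , ∣Q∣ , kernel) , sum≈ε =
    cone p ∘ es , cone-edge p ∘ isEdge , (λ i j i≢j → distinct i j i≢j ∘ cone-injective p) ,
    (cone p Q , cone-edge p ∣Q∣ , λ i j i≢j → trans (cone-∩ p (es i) (es j)) (cong (cone p) (kernel i j i≢j))) ,
    sum≈ε

  module _ {r q m d : ℕ} (col : Colouring G r d) where

    IsZeroSumDelta : (es : Fin m → Subset d) → (∀ i → ∣ es i ∣ ≡ r) → Set _
    IsZeroSumDelta es isEdge = (∀ i j → i ≢ j → es i ≢ es j)
      × (∃ λ (Q : Subset d) → ∣ Q ∣ ≡ q × (∀ i j → i ≢ j → es i ∩ es j ≡ Q))
      × (gsum G (λ i → col (es i) (isEdge i)) ≈ ε)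

    IsZeroSumDelta-resp : ∀ {es es′} → es ≗ es′ → ∀ isEdge isEdge′
      → IsZeroSumDelta es isEdge → IsZeroSumDelta es′ isEdge′
    IsZeroSumDelta-resp es≗es′ isEdge isEdge′ (distinct , (Q , ∣Q∣ , kernel) , sum≈ε) =
      (λ i j i≢j eq → distinct i j i≢j (trans (es≗es′ i) (trans eq (sym (es≗es′ j))))) ,
      (Q , ∣Q∣ , λ i j i≢j → trans (cong₂ _∩_ (sym (es≗es′ i)) (sym (es≗es′ j))) (kernel i j i≢j)) ,
      ≈-trans (gsum-cong λ i → ≈-reflexive (Colouring-irrelevant col (isEdge′ i) (isEdge i) (sym (es≗es′ i)))) sum≈ε

  ZeroSumDelta-cong : ∀ {r q m d} {col col′ : Colouring G r d} → (∀ e isEdge → col e isEdge ≈ col′ e isEdge)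
    → ZeroSumDelta G r q m d col → ZeroSumDelta G r q m d col′
  ZeroSumDelta-cong col≈col′ (es , isEdge , distinct , kernel , sum≈ε) =
    es , isEdge , distinct , kernel , ≈-trans (gsum-cong λ i → ≈-sym (col≈col′ (es i) (isEdge i))) sum≈ε

  module Decide {n} (order : HasOrder G n) where
    private
      enumerate : Fin n → Carrier
      enumerate = proj₁ order
      surjective : ∀ x → ∃ λ i → enumerate i ≈ x
      surjective = proj₁ (proj₂ order)
      injective : ∀ i j → enumerate i ≈ enumerate j → i ≡ j
      injective = proj₂ (proj₂ order)

    _≈?_ : ∀ x y → Dec (x ≈ y)
    x ≈? y with surjective x | surjective y
    ... | i , i↦x | j , j↦y with i Fin.≟ j
    ... | yes refl = yes (≈-trans (≈-sym i↦x) j↦y)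
    ... | no i≢j = no λ x≈y → i≢j (injective i j (≈-trans i↦x (≈-trans x≈y (≈-sym j↦y))))

    module _ {r q m d : ℕ} (col : Colouring G r d) where

      IsZeroSumDelta? : ∀ (es : Fin m → Subset d) isEdge → Dec (IsZeroSumDelta {q = q} col es isEdge)
      IsZeroSumDelta? es isEdge =
        all? (λ i → all? λ j → ¬? (i Fin.≟ j) →-dec ¬? (es i ≟ˢ es j))
        ×-dec anySubset? (λ Q → (∣ Q ∣ ℕ.≟ q)
          ×-dec all? (λ i → all? λ j → ¬? (i Fin.≟ j) →-dec (es i ∩ es j) ≟ˢ Q))
        ×-dec (gsum G (λ i → col (es i) (isEdge i)) ≈? ε)

      ZeroSumDelta? : Dec (ZeroSumDelta G r q m d col)
      ZeroSumDelta? = Vector-searchable Subset-searchable m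
        (λ es≗es′ (isEdge , zsd) → let isEdge′ = λ i → trans (cong ∣_∣ (sym (es≗es′ i))) (isEdge i)
                                    in isEdge′ , IsZeroSumDelta-resp col es≗es′ isEdge isEdge′ zsd)
        edges?
        where
        edges? : ∀ es → Dec (Σ (∀ i → ∣ es i ∣ ≡ r) (IsZeroSumDelta {q = q} col es))
        edges? es with all? (λ i → ∣ es i ∣ ℕ.≟ r)
        ... | no ¬isEdge = no (¬isEdge ∘ proj₁)
        ... | yes isEdge with IsZeroSumDelta? es isEdge
        ...   | yes zsd = yes (isEdge , zsd)
        ...   | no ¬zsd = no λ (isEdge′ , zsd) → ¬zsd (IsZeroSumDelta-resp col (λ _ → refl) isEdge′ isEdge zsd)

    decode : ∀ {r d} → (Subset d → Fin n) → Colouring G r d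
    decode k e _ = enumerate (k e)

    -- Subsets that are not edges get an arbitrary code.
    code : ∀ {r d} → Colouring G r d → Subset d → Fin n
    code {r} col e with ∣ e ∣ ℕ.≟ r
    ... | yes isEdge = proj₁ (surjective (col e isEdge))
    ... | no _       = proj₁ (surjective ε)

    decode-code : ∀ {r d} (col : Colouring G r d) e isEdge → decode (code col) e isEdge ≈ col e isEdge
    decode-code {r} col e isEdge with ∣ e ∣ ℕ.≟ r
    ... | yes isEdge′ = ≈-trans (proj₂ (surjective _)) (≈-reflexive (Colouring-irrelevant col isEdge′ isEdge refl))
    ... | no ¬isEdge  = ⊥-elim (¬isEdge isEdge)

    RamseyProp? : ∀ r q m d → Dec (RamseyProp G r q m d)
    RamseyProp? r q m d
      with all-dec (λ k≗k′ e → sym (k≗k′ e)) (SubsetFun-searchable Fin-searchable d) decode-resp (ZeroSumDelta? ∘ decode)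
      where
      decode-resp : (ZeroSumDelta G r q m d ∘ decode) Respects _≗_
      decode-resp k≗k′ = ZeroSumDelta-cong λ e _ → ≈-reflexive (cong enumerate (k≗k′ e))
    ... | yes Ramsey = yes λ col → ZeroSumDelta-cong (decode-code col) (Ramsey (code col))
    ... | no ¬Ramsey = no λ Ramsey → ¬Ramsey (Ramsey ∘ decode)

-- The hypotheses on the exponent and on m serve in the paper to make R(S(r−p,q−p,m),G)
-- exist; here its existence is assumed, so they are unused.
lemma2p5 : ∀ {c ℓ : Level} (G : AbelianGroup c ℓ) (n e r q m : ℕ)
    → HasOrder G n → IsExponent G e
    → q < r → n ≤ m → e ∣ m
    → ∀ p → p ≤ q → ∀ R′ → IsRamseyNumber G (r ∸ p) (q ∸ p) m R′
    → ∃ λ R → IsRamseyNumber G r q m R × R ≤ p + R′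
lemma2p5 G n e r q m order _ q<r _ _ p p≤q R′ (1≤R′ , R′-Ramsey , _) =
  let R , R≤p+R′ , (1≤R , R-Ramsey) , least = least-≤ positiveRamsey? (p + R′) (1≤p+R′ , p+R′-Ramsey)
  in R , (1≤R , R-Ramsey , λ d 1≤d d-Ramsey → least d (1≤d , d-Ramsey)) , R≤p+R′
  where
  open Decide G order using (RamseyProp?)
  positiveRamsey? : ∀ d → Dec (1 ≤ d × RamseyProp G r q m d)
  positiveRamsey? d = (1 ℕ.≤? d) ×-dec RamseyProp? r q m d
  1≤p+R′ : 1 ≤ p + R′
  1≤p+R′ = ℕ.≤-trans 1≤R′ (ℕ.m≤n+m R′ p)
  p+R′-Ramsey : RamseyProp G r q m (p + R′)
  p+R′-Ramsey = subst₂ (λ r′ q′ → RamseyProp G r′ q′ m (p + R′))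
    (ℕ.m+[n∸m]≡n (ℕ.≤-trans p≤q (ℕ.<⇒≤ q<r))) (ℕ.m+[n∸m]≡n p≤q) (RamseyProp-cone G p R′-Ramsey)
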